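{- Let $\langle K,R\rangle$ be a Kripke frame. The axiom scheme $(\varphi\rightarrow\psi)\rightarrow[(\psi\rightarrow\theta)\rightarrow(\varphi\rightarrow\theta)]$ is satisfied in $\langle K,R\rangle$ (i.e. every instance, for all formulas $\varphi,\psi,\theta$, holds at every node of every Kripke model on this frame) if and only if for every $k\in K$ the restriction of $R$ to $R^+[k]$ is transitive, i.e. for all $x,y,z\in R^+[k]$, $xRy$ and $yRz$ imply $xRz$.
   Context: Formulas are built from a countably infinite set of atoms and the constant $\bot$ (falsity) using the binary connectives $\&$ and $\rightarrow$. A Kripke frame is a pair $\langle K,R\rangle$ with $R\subseteq K\times K$ an arbitrary binary relation; a Kripke model on it is $\langle K,R,\vDash\rangle$ with $\vDash\subseteq K\times\mathsf{Atoms}$ arbitrary, extended to formulas by: $k\nvDash\bot$; $k\vDash\varphi\&\psi$ iff $k\vDash\varphi$ and $k\vDash\psi$; $k\vDash\varphi\rightarrow\psi$ iff for every $k'$ with $kRk'$, if $k'\vDash\varphi$ then $k'\vDash\psi$. For $k\in K$, $R^n[k]=\{x\mid \exists y_1,\dots,y_{n-1}\,(kRy_1R\cdots Ry_{n-1}Rx)\}$ and $R^+[k]=\bigcup_{n\ge1}R^n[k]$. -}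

module Defs where

open import Data.Nat using (ℕ)
open import Data.Empty using (⊥)
open import Data.Product using (_×_)
open import Level using (0ℓ)
open import Relation.Binary.Core using (Rel)
open import Relation.Binary.Construct.Closure.Transitive using (TransClosure)

Atom : Set
Atom = ℕ

data Formula : Set where
  atom : Atom → Formula
  ⊥'   : Formula
  _&_  : Formula → Formula → Formula
  _⇒_  : Formula → Formula → Formula

infixr 5 _⇒_
infixr 6 _&_

record Frame : Set₁ where
  field
    K : Set
    R : Rel K 0ℓ

Valuation : Frame → Set₁
Valuation F = Frame.K F → Atom → Set

Forces : (F : Frame) → Valuation F → Frame.K F → Formula → Set
Forces F V k (atom p) = V k p
Forces F V k ⊥'       = ⊥
Forces F V k (φ & ψ)  = Forces F V k φ × Forces F V k ψ
Forces F V k (φ ⇒ ψ)  =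
  ∀ k' → Frame.R F k k' → Forces F V k' φ → Forces F V k' ψ

ValidScheme : Frame → (Formula → Formula → Formula → Formula) → Set₁
ValidScheme F σ =
  ∀ (V : Valuation F) (k : Frame.K F) (φ ψ θ : Formula) → Forces F V k (σ φ ψ θ)

HS : Formula → Formula → Formula → Formula
HS φ ψ θ = (φ ⇒ ψ) ⇒ ((ψ ⇒ θ) ⇒ (φ ⇒ θ))

InRPlus : (F : Frame) → Frame.K F → Frame.K F → Set
InRPlus F k x = TransClosure (Frame.R F) k x

LocallyTransitive : Frame → Set
LocallyTransitive F = ∀ (k x y z : Frame.K F) →
  InRPlus F k x → InRPlus F k y → InRPlus F k z →
  Frame.R F x y → Frame.R F y z → Frame.R F x z

-- A node of R⁺[k] is exactly a node with an R-predecessor w, and then x, y, z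
-- lie in R[w], R²[w], R³[w]; so local transitivity says precisely that R is
-- transitive at every node that has a predecessor.  At such a w the scheme
-- transports x ⊩ φ → θ to every R-successor y of x, which is this
-- transitivity once φ holds only at z and θ only at R-successors of x.
module Submission where

open import Defs
open import Data.Nat using (zero; suc)
open import Function using (_∘_)
open import Data.Product using (_×_; _,_; ∃)
open import Relation.Binary.PropositionalEquality using (_≡_; refl)
open import Relation.Binary.Construct.Closure.Transitive using (TransClosure; [_]; _∷_)

module _ (F : Frame) where
  open Frame F

  TransitiveAtSuccessors : Set
  TransitiveAtSuccessors = ∀ {w x y z} → R w x → R x y → R y z → R x z

  predecessor : ∀ {k x} → TransClosure R k x → ∃ λ w → R w x
  predecessor {k} [ kRx ] = k , kRx
  predecessor (_ ∷ k⁺x)  = predecessor k⁺x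

  transitiveAtSuccessors⇒locallyTransitive : TransitiveAtSuccessors → LocallyTransitive F
  transitiveAtSuccessors⇒locallyTransitive trans _ _ _ _ k⁺x _ _ xRy yRz
    with predecessor k⁺x
  ... | _ , wRx = trans wRx xRy yRz

  locallyTransitive⇒transitiveAtSuccessors : LocallyTransitive F → TransitiveAtSuccessors
  locallyTransitive⇒transitiveAtSuccessors lt {w} {x} {y} {z} wRx xRy yRz =
    lt w x y z [ wRx ] (wRx ∷ [ xRy ]) (wRx ∷ xRy ∷ [ yRz ]) xRy yRz

  transitiveAtSuccessors⇒HS-valid : TransitiveAtSuccessors → ValidScheme F HS
  transitiveAtSuccessors⇒HS-valid trans V w φ ψ θ x wRx x⊩φ⇒ψ y xRy y⊩ψ⇒θ z yRz z⊩φ =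
    y⊩ψ⇒θ z yRz (x⊩φ⇒ψ z (trans wRx xRy yRz) z⊩φ)

  HS-valid⇒transitiveAtSuccessors : ValidScheme F HS → TransitiveAtSuccessors
  HS-valid⇒transitiveAtSuccessors valid {w} {x} {y} {z} wRx xRy yRz =
    valid V w (atom 0) (atom 1) (atom 1)
      x wRx (λ u xRu _ → xRu)
      y xRy (λ _ _ u⊩p₁ → u⊩p₁)
      z yRz refl
    where
    V : Valuation F
    V u zero    = u ≡ z
    V u (suc _) = R x u

theorem2 : (F : Frame) →
    (ValidScheme F HS → LocallyTransitive F) × (LocallyTransitive F → ValidScheme F HS)
theorem2 F =
    transitiveAtSuccessors⇒locallyTransitive F ∘ HS-valid⇒transitiveAtSuccessors F
  , transitiveAtSuccessors⇒HS-valid F ∘ locallyTransitive⇒transitiveAtSuccessors F
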